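{- Let $d\ge 1$ and $r_1,\dots,r_d\ge 1$ be integers, and let $P=\prod_{i=1}^d \mathbf{r_i}$ be the product of chains of sizes $r_1,\dots,r_d$. Let $r=\max_i r_i$ and let $k$ be the maximum size of a chain in $P$. In the (unordered) Maker-Breaker chain game on $P$, Maker has a strategy guaranteeing that the elements he chooses contain a chain of size $k-\lfloor r/2\rfloor$, and Breaker has a strategy guaranteeing that the elements Maker chooses contain no chain of size larger than $k-\lfloor r/2\rfloor$.
   Context: The product $\prod_{i=1}^d \mathbf{r_i}$ is the set of integer $d$-tuples $x$ with $0\le x_i<r_i$ for all $i$, ordered by $x\preceq y$ iff $x_i\le y_i$ for all $i$. In the Maker-Breaker chain game on a finite poset, Maker and Breaker alternately (Maker first) choose previously unchosen elements of the poset until all elements are chosen; the question is the largest size of a chain all of whose elements Maker has chosen (in any order). -}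

module Defs where

open import Data.Nat using (ℕ; zero; suc; _≤_; _<_; _⊔_; _%_)
open import Data.Vec using (Vec; foldr′)
open import Data.Vec.Relation.Binary.Pointwise.Inductive using (Pointwise)
open import Data.List using (List; []; _∷_; _++_; length)
open import Data.List.Membership.Propositional using (_∈_; _∉_)
open import Data.List.Relation.Unary.All using (All)
open import Data.List.Relation.Unary.Unique.Propositional using (Unique)
open import Data.List.Relation.Unary.AllPairs using (AllPairs)
open import Data.Product using (Σ; ∃; _×_)
open import Data.Sum using (_⊎_)
open import Relation.Binary.PropositionalEquality using (_≡_)

-- Elements of the product of chains r₁ × ... × r_d are represented as
-- vectors x ∈ ℕ^d with 0 ≤ x_i < r_i.
Elem : ℕ → Set
Elem d = Vec ℕ d

InP : ∀ {d} → Vec ℕ d → Elem d → Set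
InP r x = Pointwise _<_ x r

_≼_ : ∀ {d} → Elem d → Elem d → Set
x ≼ y = Pointwise _≤_ x y

Comparable : ∀ {d} → Elem d → Elem d → Set
Comparable x y = x ≼ y ⊎ y ≼ x

IsChain : ∀ {d} → Vec ℕ d → List (Elem d) → Set
IsChain r c = Unique c × All (InP r) c × AllPairs Comparable c

IsMaxChainSize : ∀ {d} → Vec ℕ d → ℕ → Set
IsMaxChainSize r k =
  (Σ (List _) λ c → IsChain r c × length c ≡ k)
  × (∀ c → IsChain r c → length c ≤ k)

maxVec : ∀ {d} → Vec ℕ d → ℕ
maxVec = foldr′ _⊔_ 0

-- A (complete) play: every element of P is chosen exactly once; the list
-- records the order in which elements were chosen (Maker picks positions
-- 0,2,4,..., Breaker positions 1,3,5,...).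
IsPlay : ∀ {d} → Vec ℕ d → List (Elem d) → Set
IsPlay r p = Unique p × All (InP r) p × (∀ x → InP r x → x ∈ p)

makerMoves  : ∀ {A : Set} → List A → List A
breakerMoves : ∀ {A : Set} → List A → List A
makerMoves [] = []
makerMoves (x ∷ xs) = x ∷ breakerMoves xs
breakerMoves [] = []
breakerMoves (x ∷ xs) = makerMoves xs

Strategy : ℕ → Set
Strategy d = List (Elem d) → Elem d

LegalStrategy : ∀ {d} → Vec ℕ d → Strategy d → Set
LegalStrategy r σ =
  ∀ h → Unique h → All (InP r) h → (∃ λ x → InP r x × x ∉ h) →
  InP r (σ h) × σ h ∉ h

-- play p follows strategy σ at every move whose index has parity `par`
-- (par = 0: Maker's moves, par = 1: Breaker's moves)
Follows : ∀ {d} → ℕ → Strategy d → List (Elem d) → Set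
Follows par σ p =
  ∀ h m t → p ≡ h ++ (m ∷ t) → length h % 2 ≡ par → m ≡ σ h

MakerHasChain : ∀ {d} → Vec ℕ d → ℕ → List (Elem d) → Set
MakerHasChain r n p =
  Σ (List _) λ c → IsChain r c × All (_∈ makerMoves p) c × length c ≡ n

MakerChainsAtMost : ∀ {d} → Vec ℕ d → ℕ → List (Elem d) → Set
MakerChainsAtMost r n p =
  ∀ c → IsChain r c → All (_∈ makerMoves p) c → length c ≤ n

-- Let N = Σᵢ (rᵢ − 1) and R = maxᵢ rᵢ.  Ranks are distinct along a chain, so chains have at most
-- N + 1 elements.  The pivots pₜ = (min(t, rᵢ − 1))ᵢ, 0 ≤ t < R, run from the bottom to the top of P,
-- and consecutive pivots span a unit cube; so k = N + 1, a chain through all the cubes being maximum.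
--
-- Both players use pairing strategies: answer the opponent's move by its twin.  Maker opens with p₀,
-- pairs the pivots p₁p₂, p₃p₄, …, and pairs the inner points of each cube so that any set meeting
-- every pair contains a chain through all the inner rank levels of the cube.  Concatenating these
-- chains with the pivots he owns misses at most ⌈(R − 1)/2⌉ = ⌊R/2⌋ rank levels.
--
-- Breaker fixes a coordinate i with rᵢ = R and pairs the values 2j, 2j + 1 of that coordinate.  The
-- weight Σ_{j≠i} xⱼ + ⌊xᵢ/2⌋ is monotone, takes at most N + 1 − ⌊R/2⌋ values, and distinct comparable
-- points of equal weight are twins; as Maker never owns both twins, it is injective on his chains.

module Submission where

open import Defs
open import Data.Nat using (ℕ; zero; suc; pred; _+_; _*_; _%_; _∸_; _⊔_; _⊓_; _≤_; _<_; z≤n; s≤s; s≤s⁻¹; _/_; ⌊_/2⌋; ⌈_/2⌉)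
open import Data.Nat.Properties
open import Data.Nat.DivMod using (m/n≡1+[m∸n]/n)
open import Data.Fin using (Fin; zero; suc)
open import Data.Vec using (Vec; []; _∷_; sum; map; lookup)
open import Data.Vec.Relation.Binary.Pointwise.Inductive as PW using ([]; _∷_)
import Data.Vec.Properties as VecP
open import Data.Vec.Relation.Unary.All using () renaming (All to VecAll; [] to []ᵛ; _∷_ to _∷ᵛ_)
open import Data.List as List using (List; []; _∷_; _++_; [_]; length; last; filter; upTo; cartesianProductWith)
open import Data.Maybe using (just; nothing)
open import Data.List.Properties using (length-map; length-take; length-++; ++-assoc; ∷-injectiveʳ; filter-all; filter-accept; filter-reject)
open import Data.List.Relation.Unary.All as All using (All; []; _∷_)
import Data.List.Relation.Unary.All.Properties as AllP
open import Data.List.Relation.Unary.AllPairs as AllPairs using (AllPairs; []; _∷_)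
import Data.List.Relation.Unary.AllPairs.Properties as AllPairsP
open import Data.List.Relation.Unary.Unique.Propositional using (Unique)
import Data.List.Relation.Unary.Unique.Propositional.Properties as UniqueP
open import Data.List.Membership.Propositional using (_∈_; _∉_)
import Data.List.Membership.DecPropositional as DecMembership
open import Data.List.Membership.Propositional.Properties
  using (∈-++⁺ʳ; ∈-++⁻; ∈-∃++; ∈-cartesianProductWith⁺; ∈-cartesianProductWith⁻; ∈-upTo⁺; ∈-upTo⁻)
open import Data.List.Relation.Unary.Any using (here; there)
open import Data.Product using (Σ; ∃; ∃₂; _×_; _,_; proj₁; proj₂)
open import Data.Sum as Sum using (_⊎_; inj₁; inj₂)
open import Function using (_∘_)
open import Data.Unit using (⊤; tt)
open import Data.Nat.Tactic.RingSolver using (solve-∀)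
open import Relation.Unary using (Decidable)
open import Relation.Binary.Definitions using (DecidableEquality)
open import Relation.Nullary using (¬_; Dec; yes; no; ¬?; _×-dec_; contradiction)
open import Relation.Binary.PropositionalEquality
  using (_≡_; _≢_; refl; sym; trans; cong; cong₂; subst; subst₂; module ≡-Reasoning)

_≟ᵉ_ : ∀ {d} → DecidableEquality (Elem d)
_≟ᵉ_ = VecP.≡-dec _≟_

rank : ∀ {d} → Elem d → ℕ
rank = sum

≼-refl : ∀ {d} {x : Elem d} → x ≼ x
≼-refl = PW.refl ≤-refl

≼-trans : ∀ {d} {x y z : Elem d} → x ≼ y → y ≼ z → x ≼ z
≼-trans = PW.trans ≤-trans

≼-antisym : ∀ {d} {x y : Elem d} → x ≼ y → y ≼ x → x ≡ y
≼-antisym [] [] = refl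
≼-antisym (a ∷ as) (b ∷ bs) = cong₂ _∷_ (≤-antisym a b) (≼-antisym as bs)

≼-InP : ∀ {d} {r : Vec ℕ d} {x y : Elem d} → x ≼ y → InP r y → InP r x
≼-InP = PW.trans ≤-<-trans

rank-mono : ∀ {d} {x y : Elem d} → x ≼ y → rank x ≤ rank y
rank-mono [] = z≤n
rank-mono (a ∷ as) = +-mono-≤ a (rank-mono as)

+-mono-≤-≡⇒≡ : ∀ {a b c e} → a ≤ b → c ≤ e → a + c ≡ b + e → a ≡ b × c ≡ e
+-mono-≤-≡⇒≡ {a} {b} {c} {e} a≤b c≤e a+c≡b+e = a≡b , +-cancelˡ-≡ a c e (trans a+c≡b+e (cong (_+ e) (sym a≡b)))
  where
  a≡b : a ≡ b
  a≡b = ≤-antisym a≤b (+-cancelʳ-≤ e b a (≤-trans (≤-reflexive (sym a+c≡b+e)) (+-monoʳ-≤ a c≤e)))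

≼∧rank≡⇒≡ : ∀ {d} {x y : Elem d} → x ≼ y → rank x ≡ rank y → x ≡ y
≼∧rank≡⇒≡ [] _ = refl
≼∧rank≡⇒≡ (a ∷ as) e with +-mono-≤-≡⇒≡ a (rank-mono as) e
... | refl , e′ = cong (_ ∷_) (≼∧rank≡⇒≡ as e′)

Comparable⇒rank≢ : ∀ {d} {x y : Elem d} → x ≢ y → Comparable x y → rank x ≢ rank y
Comparable⇒rank≢ x≢y (inj₁ x≼y) e = x≢y (≼∧rank≡⇒≡ x≼y e)
Comparable⇒rank≢ x≢y (inj₂ y≼x) e = x≢y (sym (≼∧rank≡⇒≡ y≼x (sym e)))

_≺_ : ∀ {d} → Elem d → Elem d → Set
x ≺ y = x ≼ y × x ≢ y

≼-≺-trans : ∀ {d} {x y z : Elem d} → x ≼ y → y ≺ z → x ≺ z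
≼-≺-trans x≼y (y≼z , y≢z) = ≼-trans x≼y y≼z , λ { refl → y≢z (≼-antisym y≼z x≼y) }

≤∷≺⇒≺ : ∀ {d} {l m} {x y : Elem d} → l ≤ m → x ≺ y → (l ∷ x) ≺ (m ∷ y)
≤∷≺⇒≺ l≤m (x≼y , x≢y) = l≤m ∷ x≼y , λ { refl → x≢y refl }

<∷≼⇒≺ : ∀ {d} {l m} {x y : Elem d} → l < m → x ≼ y → (l ∷ x) ≺ (m ∷ y)
<∷≼⇒≺ l<m x≼y = <⇒≤ l<m ∷ x≼y , λ { refl → <-irrefl refl l<m }

∷-≺-∷⁻ : ∀ {d} {l} {x y : Elem d} → (l ∷ x) ≺ (l ∷ y) → x ≺ y
∷-≺-∷⁻ (_ ∷ x≼y , lx≢ly) = x≼y , lx≢ly ∘ cong (_ ∷_)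

IsChain-≺ : ∀ {d} {r : Vec ℕ d} {c : List (Elem d)} → AllPairs _≺_ c → All (InP r) c → IsChain r c
IsChain-≺ c↑ c∈P = AllPairs.map proj₂ c↑ , c∈P , AllPairs.map (inj₁ ∘ proj₁) c↑

≢? : ∀ n → Decidable (_≢ n)
≢? n y = ¬? (y ≟ n)

length≤1+length-filter≢ : ∀ n {xs : List ℕ} → Unique xs → length xs ≤ suc (length (filter (≢? n) xs))
length≤1+length-filter≢ n {[]} _ = z≤n
length≤1+length-filter≢ n {x ∷ xs} (x∉xs ∷ u) with x ≟ n
... | yes refl = begin
  suc (length xs)                       ≡⟨ cong (suc ∘ length) (filter-all (≢? n) (All.map (_∘ sym) x∉xs)) ⟨
  suc (length (filter (≢? n) xs))       ≡⟨ cong (suc ∘ length) (filter-reject (≢? n) (λ n≢n → n≢n refl)) ⟨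
  suc (length (filter (≢? n) (n ∷ xs))) ∎
  where open ≤-Reasoning
... | no x≢n = begin
  suc (length xs)                       ≤⟨ s≤s (length≤1+length-filter≢ n u) ⟩
  suc (suc (length (filter (≢? n) xs))) ≡⟨ cong (suc ∘ length) (filter-accept (≢? n) x≢n) ⟨
  suc (length (filter (≢? n) (x ∷ xs))) ∎
  where open ≤-Reasoning

pigeonhole : ∀ n {xs : List ℕ} → Unique xs → All (_< n) xs → length xs ≤ n
pigeonhole zero {[]} _ _ = z≤n
pigeonhole zero {_ ∷ _} _ (() ∷ _)
pigeonhole (suc n) {xs} u xs<1+n =
  ≤-trans (length≤1+length-filter≢ n u) (s≤s (pigeonhole n (UniqueP.filter⁺ (≢? n) u) rest<n))
  where
  rest<n : All (_< n) (filter (≢? n) xs)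
  rest<n = All.zipWith (λ (y<1+n , y≢n) → ≤∧≢⇒< (s≤s⁻¹ y<1+n) y≢n)
                       (AllP.filter⁺ (≢? n) xs<1+n , AllP.all-filter (≢? n) xs)

length-≤-by-injection : ∀ {A : Set} (f : A → ℕ) {n} {xs : List A} →
  AllPairs (λ x y → f x ≢ f y) xs → All (λ x → f x < n) xs → length xs ≤ n
length-≤-by-injection f {n} {xs} f-inj f<n =
  subst (_≤ n) (length-map f xs) (pigeonhole n (AllPairsP.map⁺ f-inj) (AllP.map⁺ f<n))

AllPairs-with : ∀ {A : Set} {P : A → Set} {R : A → A → Set} {xs : List A} →
  All P xs → AllPairs R xs → AllPairs (λ x y → (P x × P y) × R x y) xs
AllPairs-with [] [] = []
AllPairs-with (Px ∷ Pxs) (Rx ∷ Rxs) = All.zipWith (λ (Py , Rxy) → (Px , Py) , Rxy) (Pxs , Rx) ∷ AllPairs-with Pxs Rxs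

height : ∀ {d} → Vec ℕ d → ℕ
height r = sum (map pred r)

rank≤height : ∀ {d} {r : Vec ℕ d} {x : Elem d} → InP r x → rank x ≤ height r
rank≤height [] = z≤n
rank≤height (x<n ∷ xs<r) = +-mono-≤ (<⇒≤pred x<n) (rank≤height xs<r)

chain-length≤1+height : ∀ {d} (r : Vec ℕ d) {c} → IsChain r c → length c ≤ suc (height r)
chain-length≤1+height r (unique , c∈P , comparable) =
  length-≤-by-injection rank (AllPairs.zipWith (λ (x≢y , x~y) → Comparable⇒rank≢ x≢y x~y) (unique , comparable))
    (All.map (s≤s ∘ rank≤height) c∈P)

elements : ∀ {d} → Vec ℕ d → List (Elem d)
elements [] = [ [] ]
elements (n ∷ r) = cartesianProductWith _∷_ (upTo n) (elements r)

elements-sound : ∀ {d} (r : Vec ℕ d) → All (InP r) (elements r)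
elements-sound r = All.tabulate (sound r)
  where
  sound : ∀ {d} (r : Vec ℕ d) {x} → x ∈ elements r → InP r x
  sound [] (here refl) = []
  sound (n ∷ r) x∈ with ∈-cartesianProductWith⁻ _∷_ (upTo n) (elements r) x∈
  ... | _ , _ , i∈ , xs∈ , refl = ∈-upTo⁻ i∈ ∷ sound r xs∈

elements-complete : ∀ {d} (r : Vec ℕ d) x → InP r x → x ∈ elements r
elements-complete [] [] [] = here refl
elements-complete (n ∷ r) (x ∷ xs) (x<n ∷ xs<r) =
  ∈-cartesianProductWith⁺ _∷_ (∈-upTo⁺ x<n) (elements-complete r xs xs<r)

InP? : ∀ {d} (r : Vec ℕ d) → Decidable (InP r)
InP? r x = PW.decidable _<?_ x r

origin : ∀ {d} → Vec ℕ d → Elem d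
origin r = map (λ _ → 0) r

origin-InP : ∀ {d} {r : Vec ℕ d} → VecAll (1 ≤_) r → InP r (origin r)
origin-InP []ᵛ = []
origin-InP (1≤n ∷ᵛ r≥1) = 1≤n ∷ origin-InP r≥1

rank-origin : ∀ {d} (r : Vec ℕ d) → rank (origin r) ≡ 0
rank-origin [] = refl
rank-origin (n ∷ r) = rank-origin r

last-∷ʳ : ∀ {A : Set} (xs : List A) x → last (xs ++ [ x ]) ≡ just x
last-∷ʳ [] x = refl
last-∷ʳ (y ∷ []) x = refl
last-∷ʳ (y ∷ z ∷ xs) x = last-∷ʳ (z ∷ xs) x

last≡nothing⇒[] : ∀ {A : Set} (xs : List A) → last xs ≡ nothing → xs ≡ []
last≡nothing⇒[] [] _ = refl
last≡nothing⇒[] (y ∷ []) ()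
last≡nothing⇒[] (y ∷ z ∷ xs) e with () ← last≡nothing⇒[] (z ∷ xs) e

Unique-++⇒∉ : ∀ {A : Set} (xs : List A) {ys y} → Unique (xs ++ ys) → y ∈ ys → y ∉ xs
Unique-++⇒∉ (x ∷ xs) (x∉ ∷ _) y∈ys (here refl) = All.lookup x∉ (∈-++⁺ʳ xs y∈ys) refl
Unique-++⇒∉ (x ∷ xs) (_ ∷ u) y∈ys (there y∈xs) = Unique-++⇒∉ xs u y∈ys y∈xs

position-unique : ∀ {A : Set} {x : A} (a c : List A) {b d} →
  Unique (a ++ x ∷ b) → a ++ x ∷ b ≡ c ++ x ∷ d → length a ≡ length c
position-unique [] [] _ _ = refl
position-unique [] (y ∷ c) u refl = contradiction (∈-++⁺ʳ c (here refl)) (UniqueP.Unique[x∷xs]⇒x∉xs u)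
position-unique (y ∷ a) [] u refl = contradiction (∈-++⁺ʳ a (here refl)) (UniqueP.Unique[x∷xs]⇒x∉xs u)
position-unique (y ∷ a) (z ∷ c) (_ ∷ u) e = cong suc (position-unique a c u (∷-injectiveʳ e))

suc-%2 : ∀ {par} n → par ≤ 1 → n % 2 ≢ par → suc n % 2 ≡ par
suc-%2 {0} 0 _ ne = contradiction refl ne
suc-%2 {1} 0 _ _ = refl
suc-%2 {0} 1 _ _ = refl
suc-%2 {1} 1 _ ne = contradiction refl ne
suc-%2 {suc (suc _)} _ (s≤s ())
suc-%2 (suc (suc n)) par≤1 ne = suc-%2 n par≤1 ne

PlayedAt : ∀ {A : Set} → List A → ℕ → A → Set
PlayedAt p par x = ∃₂ λ h t → p ≡ h ++ x ∷ t × length h % 2 ≡ par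

PlayedAt-unique : ∀ {A : Set} {p : List A} {x q₁ q₂} → Unique p → PlayedAt p q₁ x → PlayedAt p q₂ x → q₁ ≡ q₂
PlayedAt-unique u (h₁ , t₁ , refl , q₁) (h₂ , t₂ , e , q₂) =
  trans (sym q₁) (trans (cong (_% 2) (position-unique h₁ h₂ u e)) q₂)

PlayedAt⇒∈makerMoves : ∀ {A : Set} {p : List A} {x} → PlayedAt p 0 x → x ∈ makerMoves p
PlayedAt⇒∈makerMoves ([] , t , refl , _) = here refl
PlayedAt⇒∈makerMoves (_ ∷ _ ∷ h , t , refl , e) = there (PlayedAt⇒∈makerMoves (h , t , refl , e))

∈makerMoves⇒PlayedAt : ∀ {A : Set} {x : A} p → x ∈ makerMoves p → PlayedAt p 0 x
∈breakerMoves⇒PlayedAt : ∀ {A : Set} {x : A} p → x ∈ breakerMoves p → PlayedAt p 1 x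
∈makerMoves⇒PlayedAt (y ∷ p) (here refl) = [] , p , refl , refl
∈makerMoves⇒PlayedAt (y ∷ p) (there x∈) with h , t , refl , e ← ∈breakerMoves⇒PlayedAt p x∈ =
  y ∷ h , t , refl , suc-%2 (length h) z≤n (λ e′ → 1+n≢0 (trans (sym e) e′))
∈breakerMoves⇒PlayedAt (y ∷ p) x∈ with h , t , refl , e ← ∈makerMoves⇒PlayedAt p x∈ =
  y ∷ h , t , refl , suc-%2 (length h) ≤-refl (λ e′ → 0≢1+n (trans (sym e) e′))

module PairingStrategy {d} {P : Elem d → Set} (P? : Decidable P)
  (universe : List (Elem d)) (universe-sound : All P universe) (universe-complete : ∀ x → P x → x ∈ universe)
  (opening : Elem d) (opening∈P : P opening) (twin : Elem d → Elem d) where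

  open DecMembership (_≟ᵉ_ {d}) using (_∈?_)

  firstFree : List (Elem d) → List (Elem d) → Elem d
  firstFree [] h = opening
  firstFree (y ∷ ys) h with y ∈? h
  ... | yes _ = firstFree ys h
  ... | no _ = y

  firstFree-legal : ∀ ys h → All P ys → (∃ λ z → z ∈ ys × z ∉ h) → P (firstFree ys h) × firstFree ys h ∉ h
  firstFree-legal (y ∷ ys) h (Py ∷ Pys) (z , z∈ , z∉h) with y ∈? h | z∈
  ... | no y∉h | _ = Py , y∉h
  ... | yes y∈h | here refl = contradiction y∈h z∉h
  ... | yes _ | there z∈ys = firstFree-legal ys h Pys (z , z∈ys , z∉h)

  respond : Elem d → List (Elem d) → Elem d
  respond x h with twin x ∈? h | P? (twin x)
  ... | no _ | yes _ = twin x
  ... | _ | _ = firstFree universe h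

  strategy : Strategy d
  strategy h with last h
  ... | nothing = opening
  ... | just x = respond x h

  strategy-legal : ∀ h → (∃ λ z → P z × z ∉ h) → P (strategy h) × strategy h ∉ h
  strategy-legal h (z , Pz , z∉h) with last h in e
  ... | nothing rewrite last≡nothing⇒[] h e = opening∈P , λ ()
  ... | just x with twin x ∈? h | P? (twin x)
  ...   | no y∉h | yes Py = Py , y∉h
  ...   | yes _ | _ = firstFree-legal universe h universe-sound (z , universe-complete z Pz , z∉h)
  ...   | no _ | no _ = firstFree-legal universe h universe-sound (z , universe-complete z Pz , z∉h)

  strategy-answers : ∀ h x → twin x ∉ h ++ [ x ] → P (twin x) → strategy (h ++ [ x ]) ≡ twin x
  strategy-answers h x y∉ Py rewrite last-∷ʳ h x with twin x ∈? (h ++ [ x ]) | P? (twin x)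
  ... | yes y∈ | _ = contradiction y∈ y∉
  ... | no _ | yes _ = refl
  ... | no _ | no ¬Py = contradiction Py ¬Py

  module Play (par : ℕ) (par≤1 : par ≤ 1) (p : List (Elem d)) (p-unique : Unique p)
    (p-covers : ∀ x → P x → x ∈ p) (follows : Follows par strategy p) where

    answer-later : ∀ {h x t} → p ≡ h ++ x ∷ t → length h % 2 ≢ par →
      twin x ∉ h → twin x ≢ x → P (twin x) → twin x ∈ t → PlayedAt p par (twin x)
    answer-later {h} {x} {m ∷ t} p≡ h≢par y∉h y≢x Py _ = h ++ [ x ] , t , p≡′ , parity
      where
      parity : length (h ++ [ x ]) % 2 ≡ par
      parity = subst (λ n → n % 2 ≡ par) (sym (trans (length-++ h) (+-comm (length h) 1)))
                 (suc-%2 (length h) par≤1 h≢par)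
      assoc : h ++ x ∷ m ∷ t ≡ (h ++ [ x ]) ++ m ∷ t
      assoc = sym (++-assoc h [ x ] (m ∷ t))
      y∉h∷ʳx : twin x ∉ h ++ [ x ]
      y∉h∷ʳx y∈ with ∈-++⁻ h y∈
      ... | inj₁ y∈h = y∉h y∈h
      ... | inj₂ (here y≡x) = y≢x y≡x
      m≡y : m ≡ twin x
      m≡y = trans (follows (h ++ [ x ]) m t (trans p≡ assoc) parity) (strategy-answers h x y∉h∷ʳx Py)
      p≡′ : p ≡ (h ++ [ x ]) ++ twin x ∷ t
      p≡′ = trans p≡ (trans assoc (cong (λ y → (h ++ [ x ]) ++ y ∷ t) m≡y))

    twin-answered : ∀ {h x t} → p ≡ h ++ x ∷ t → length h % 2 ≢ par →
      P x → twin x ≢ x → twin (twin x) ≡ x → P (twin x) → PlayedAt p par (twin x)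
    twin-answered {h} {x} {t} p≡ h≢par Px y≢x yy≡x Py with ∈-++⁻ h (subst (twin x ∈_) p≡ (p-covers _ Py))
    ... | inj₂ (here y≡x) = contradiction y≡x y≢x
    ... | inj₂ (there y∈t) =
      answer-later p≡ h≢par (Unique-++⇒∉ h (subst Unique p≡ p-unique) (there y∈t)) y≢x Py y∈t
    -- twin x came before x: had the opponent played it, we would have answered with x.
    ... | inj₁ y∈h with ∈-∃++ y∈h
    ...   | a , c , refl with length a % 2 Data.Nat.≟ par
    ...     | yes a≡par = a , c ++ x ∷ t , trans p≡ (++-assoc a (twin x ∷ c) (x ∷ t)) , a≡par
    ...     | no a≢par = contradiction
                           (PlayedAt-unique p-unique (h , t , p≡ , refl) x-ours) h≢par
      where
      p≡′ : p ≡ a ++ twin x ∷ c ++ x ∷ t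
      p≡′ = trans p≡ (++-assoc a (twin x ∷ c) (x ∷ t))
      x∉a : twin (twin x) ∉ a
      x∉a = subst (_∉ a) (sym yy≡x)
              (Unique-++⇒∉ a (subst Unique p≡′ p-unique) (there (∈-++⁺ʳ c (here refl))))
      x-ours : PlayedAt p par x
      x-ours = subst (PlayedAt p par) yy≡x
        (answer-later p≡′ a≢par x∉a (λ e → y≢x (trans (sym e) yy≡x))
          (subst P (sym yy≡x) Px) (subst (_∈ c ++ x ∷ t) (sym yy≡x) (∈-++⁺ʳ c (here refl))))

    pairing-player-gets-one : ∀ x → P x → twin x ≢ x → twin (twin x) ≡ x → P (twin x) →
      PlayedAt p par x ⊎ PlayedAt p par (twin x)
    pairing-player-gets-one x Px y≢x yy≡x Py with h , t , p≡ ← ∈-∃++ (p-covers x Px) | length h % 2 Data.Nat.≟ par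
    ... | yes h≡par = inj₁ (h , t , p≡ , h≡par)
    ... | no h≢par = inj₂ (twin-answered p≡ h≢par Px y≢x yy≡x Py)

    opponent-gets-at-most-one : ∀ {q} x → q ≢ par → P x → twin x ≢ x → twin (twin x) ≡ x → P (twin x) →
      PlayedAt p q x → ¬ PlayedAt p q (twin x)
    opponent-gets-at-most-one x q≢par Px y≢x yy≡x Py (h , t , p≡ , h≡q) y-theirs =
      q≢par (PlayedAt-unique p-unique y-theirs
               (twin-answered p≡ (λ h≡par → q≢par (trans (sym h≡q) h≡par)) Px y≢x yy≡x Py))

-- Pairs 2j with 2j + 1 in {0, …, n − 1}; for odd n the last element is its own twin.
twin : ℕ → ℕ → ℕ
twin (suc (suc n)) 0 = 1
twin (suc (suc n)) 1 = 0
twin (suc (suc n)) (suc (suc x)) = suc (suc (twin n x))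
twin _ x = x

twin-< : ∀ {n x} → x < n → twin n x < n
twin-< {suc zero} {zero} _ = s≤s z≤n
twin-< {suc zero} {suc _} (s≤s ())
twin-< {suc (suc n)} {zero} _ = s≤s (s≤s z≤n)
twin-< {suc (suc n)} {suc zero} _ = s≤s z≤n
twin-< {suc (suc n)} {suc (suc x)} (s≤s (s≤s x<n)) = s≤s (s≤s (twin-< x<n))

twin-involutive : ∀ {n x} → x < n → twin n (twin n x) ≡ x
twin-involutive {suc zero} {zero} _ = refl
twin-involutive {suc zero} {suc _} (s≤s ())
twin-involutive {suc (suc n)} {zero} _ = refl
twin-involutive {suc (suc n)} {suc zero} _ = refl
twin-involutive {suc (suc n)} {suc (suc x)} (s≤s (s≤s x<n)) = cong (λ y → suc (suc y)) (twin-involutive x<n)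

⌊/2⌋≡⇒≡⊎twin : ∀ {n x y} → x ≤ y → y < n → ⌊ x /2⌋ ≡ ⌊ y /2⌋ → x ≡ y ⊎ y ≡ twin n x
⌊/2⌋≡⇒≡⊎twin {x = zero} {zero} _ _ _ = inj₁ refl
⌊/2⌋≡⇒≡⊎twin {suc (suc n)} {zero} {suc zero} _ _ _ = inj₂ refl
⌊/2⌋≡⇒≡⊎twin {suc zero} {zero} {suc zero} _ (s≤s ()) _
⌊/2⌋≡⇒≡⊎twin {x = suc zero} {suc zero} _ _ _ = inj₁ refl
⌊/2⌋≡⇒≡⊎twin {suc (suc n)} {suc (suc x)} {suc (suc y)} (s≤s (s≤s x≤y)) (s≤s (s≤s y<n)) e
  with ⌊/2⌋≡⇒≡⊎twin {n} x≤y y<n (suc-injective e)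
... | inj₁ refl = inj₁ refl
... | inj₂ refl = inj₂ refl

twinAt : ∀ {d} → Vec ℕ d → Fin d → Elem d → Elem d
twinAt (n ∷ r) zero (x ∷ xs) = twin n x ∷ xs
twinAt (n ∷ r) (suc i) (x ∷ xs) = x ∷ twinAt r i xs

twinAt-involutive : ∀ {d} {r : Vec ℕ d} i {x} → InP r x → twinAt r i (twinAt r i x) ≡ x
twinAt-involutive zero (x<n ∷ _) = cong (_∷ _) (twin-involutive x<n)
twinAt-involutive (suc i) (_ ∷ xs<r) = cong (_ ∷_) (twinAt-involutive i xs<r)

weightAt : ∀ {d} → Fin d → Elem d → ℕ
weightAt zero (x ∷ xs) = ⌊ x /2⌋ + rank xs
weightAt (suc i) (x ∷ xs) = x + weightAt i xs

weightAt-mono : ∀ {d} i {x y : Elem d} → x ≼ y → weightAt i x ≤ weightAt i y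
weightAt-mono zero (a ∷ as) = +-mono-≤ (⌊n/2⌋-mono a) (rank-mono as)
weightAt-mono (suc i) (a ∷ as) = +-mono-≤ a (weightAt-mono i as)

weightAt≡⇒≡⊎twin : ∀ {d} {r : Vec ℕ d} i {x y} → x ≼ y → InP r y →
  weightAt i x ≡ weightAt i y → x ≡ y ⊎ y ≡ twinAt r i x
weightAt≡⇒≡⊎twin zero (a ∷ as) (y<n ∷ _) e with +-mono-≤-≡⇒≡ (⌊n/2⌋-mono a) (rank-mono as) e
... | e₀ , e′ with ≼∧rank≡⇒≡ as e′ | ⌊/2⌋≡⇒≡⊎twin a y<n e₀
...   | refl | inj₁ refl = inj₁ refl
...   | refl | inj₂ refl = inj₂ refl
weightAt≡⇒≡⊎twin (suc i) (a ∷ as) (_ ∷ ys<r) e with +-mono-≤-≡⇒≡ a (weightAt-mono i as) e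
... | refl , e′ with weightAt≡⇒≡⊎twin i as ys<r e′
...   | inj₁ refl = inj₁ refl
...   | inj₂ refl = inj₂ refl

weightAt+⌊/2⌋≤height : ∀ {d} {r : Vec ℕ d} i {x} → InP r x → weightAt i x + ⌊ lookup r i /2⌋ ≤ height r
weightAt+⌊/2⌋≤height {r = suc n ∷ r} zero {x ∷ xs} (s≤s x≤n ∷ xs<r) = begin
  ⌊ x /2⌋ + rank xs + ⌈ n /2⌉    ≡⟨ +-comm (⌊ x /2⌋ + rank xs) _ ⟩
  ⌈ n /2⌉ + (⌊ x /2⌋ + rank xs)  ≡⟨ +-assoc ⌈ n /2⌉ _ _ ⟨
  ⌈ n /2⌉ + ⌊ x /2⌋ + rank xs    ≤⟨ +-mono-≤ (+-monoʳ-≤ ⌈ n /2⌉ (⌊n/2⌋-mono x≤n)) (rank≤height xs<r) ⟩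
  ⌈ n /2⌉ + ⌊ n /2⌋ + height r   ≡⟨ cong (_+ height r) (trans (+-comm ⌈ n /2⌉ _) (⌊n/2⌋+⌈n/2⌉≡n n)) ⟩
  n + height r                   ∎
  where open ≤-Reasoning
weightAt+⌊/2⌋≤height {r = suc n ∷ r} (suc i) {x ∷ xs} (s≤s x≤n ∷ xs<r) = begin
  x + weightAt i xs + ⌊ lookup r i /2⌋    ≡⟨ +-assoc x _ _ ⟩
  x + (weightAt i xs + ⌊ lookup r i /2⌋)  ≤⟨ +-mono-≤ x≤n (weightAt+⌊/2⌋≤height i xs<r) ⟩
  n + height r                            ∎
  where open ≤-Reasoning

breaker-strategy : ∀ {d} (r : Vec ℕ d) → VecAll (1 ≤_) r → (i : Fin d) →
  Σ (Strategy d) λ τ → LegalStrategy r τ ×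
    (∀ p → IsPlay r p → Follows 1 τ p → MakerChainsAtMost r (suc (height r) ∸ ⌊ lookup r i /2⌋) p)
breaker-strategy r r≥1 i = strategy , (λ h _ _ free → strategy-legal h free) , bound
  where
  open PairingStrategy (InP? r) (elements r) (elements-sound r) (elements-complete r)
                       (origin r) (origin-InP r≥1) (twinAt r i)

  bound : ∀ p → IsPlay r p → Follows 1 strategy p → MakerChainsAtMost r (suc (height r) ∸ ⌊ lookup r i /2⌋) p
  bound p (p-unique , _ , p-covers) follows c (c-unique , c∈P , comparable) c⊆M =
    length-≤-by-injection (weightAt i)
      (AllPairs.map separated (AllPairs-with (All.zip (c∈P , c⊆M)) (AllPairs.zip (c-unique , comparable))))
      (All.map (λ x∈P → m+n≤o⇒m≤o∸n (suc _) (s≤s (weightAt+⌊/2⌋≤height i x∈P))) c∈P)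
    where
    open Play 1 ≤-refl p p-unique p-covers follows

    not-twins : ∀ {x y} → InP r x × x ∈ makerMoves p → InP r y × y ∈ makerMoves p →
      x ≢ y → x ≼ y → weightAt i x ≢ weightAt i y
    not-twins (x∈P , x∈M) (y∈P , y∈M) x≢y x≼y e with weightAt≡⇒≡⊎twin i x≼y y∈P e
    ... | inj₁ x≡y = x≢y x≡y
    ... | inj₂ refl = opponent-gets-at-most-one _ 0≢1+n x∈P (x≢y ∘ sym) (twinAt-involutive i x∈P) y∈P
                        (∈makerMoves⇒PlayedAt p x∈M) (∈makerMoves⇒PlayedAt p y∈M)

    separated : ∀ {x y} → ((InP r x × x ∈ makerMoves p) × (InP r y × y ∈ makerMoves p)) × (x ≢ y × Comparable x y) →
      weightAt i x ≢ weightAt i y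
    separated ((x∈ , y∈) , x≢y , inj₁ x≼y) = not-twins x∈ y∈ x≢y x≼y
    separated ((x∈ , y∈) , x≢y , inj₂ y≼x) = not-twins y∈ x∈ (x≢y ∘ sym) y≼x ∘ sym

data Cube : ∀ {d} → Elem d → Elem d → Set where
  []    : Cube [] []
  fixed : ∀ {d} l {lo hi : Elem d} → Cube lo hi → Cube (l ∷ lo) (l ∷ hi)
  free  : ∀ {d} l {lo hi : Elem d} → Cube lo hi → Cube (l ∷ lo) (suc l ∷ hi)

Inner : ∀ {d} → Elem d → Elem d → Elem d → Set
Inner lo hi x = lo ≺ x × x ≺ hi

cube-≼ : ∀ {d} {lo hi : Elem d} → Cube lo hi → lo ≼ hi
cube-≼ [] = []
cube-≼ (fixed l c) = ≤-refl ∷ cube-≼ c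
cube-≼ (free l c) = n≤1+n l ∷ cube-≼ c

-- The free first coordinate splits the cube into a lower and an upper face.  The top of the
-- lower face is paired with the bottom of the upper face; all other pairs lie inside one face.
cubeTwin : ∀ {d} {lo hi : Elem d} → Cube lo hi → Elem d → Elem d
cubeTwin [] [] = []
cubeTwin (fixed l c) (x ∷ xs) = x ∷ cubeTwin c xs
cubeTwin (free l {lo} {hi} c) x with x ≟ᵉ (l ∷ hi) | x ≟ᵉ (suc l ∷ lo)
... | yes _ | _ = suc l ∷ lo
... | no _ | yes _ = l ∷ hi
cubeTwin (free l c) (x ∷ xs) | no _ | no _ = x ∷ cubeTwin c xs

cubeTwin-free-top : ∀ {d} l {lo hi : Elem d} (c : Cube lo hi) → cubeTwin (free l c) (l ∷ hi) ≡ suc l ∷ lo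
cubeTwin-free-top l {hi = hi} c with (l ∷ hi) ≟ᵉ (l ∷ hi)
... | yes _ = refl
... | no ne = contradiction refl ne

cubeTwin-free-bottom : ∀ {d} l {lo hi : Elem d} (c : Cube lo hi) → cubeTwin (free l c) (suc l ∷ lo) ≡ l ∷ hi
cubeTwin-free-bottom l {lo} {hi} c with (suc l ∷ lo) ≟ᵉ (l ∷ hi) | (suc l ∷ lo) ≟ᵉ (suc l ∷ lo)
... | yes e | _ = contradiction (VecP.∷-injectiveˡ e) (1+n≢n)
... | no _ | yes _ = refl
... | no _ | no ne = contradiction refl ne

cubeTwin-free-face : ∀ {d} l {lo hi : Elem d} (c : Cube lo hi) {x xs} →
  (x ∷ xs) ≢ (l ∷ hi) → (x ∷ xs) ≢ (suc l ∷ lo) → cubeTwin (free l c) (x ∷ xs) ≡ x ∷ cubeTwin c xs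
cubeTwin-free-face l {lo} {hi} c {x} {xs} ne₁ ne₂ with (x ∷ xs) ≟ᵉ (l ∷ hi) | (x ∷ xs) ≟ᵉ (suc l ∷ lo)
... | yes e | _ = contradiction e ne₁
... | no _ | yes e = contradiction e ne₂
... | no _ | no _ = refl

tail-≢ : ∀ {d} {m k} {y z : Elem d} → y ≢ z → (m ∷ y) ≢ (k ∷ z)
tail-≢ y≢z = y≢z ∘ VecP.∷-injectiveʳ

between-suc : ∀ {l x} → l ≤ x → x ≤ suc l → x ≡ l ⊎ x ≡ suc l
between-suc l≤x x≤1+l with m≤n⇒m<n∨m≡n x≤1+l
... | inj₁ x<1+l = inj₁ (≤-antisym (s≤s⁻¹ x<1+l) l≤x)
... | inj₂ x≡1+l = inj₂ x≡1+l

lift-face : ∀ {d} {l m h} {lo hi y : Elem d} → l ≤ m → m ≤ h → Inner lo hi y → Inner (l ∷ lo) (h ∷ hi) (m ∷ y)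
lift-face l≤m m≤h (lo≺y , y≺hi) = ≤∷≺⇒≺ l≤m lo≺y , ≤∷≺⇒≺ m≤h y≺hi

top-of-lower-face : ∀ {d} l {lo hi : Elem d} → Cube lo hi → lo ≢ hi → Inner (l ∷ lo) (suc l ∷ hi) (l ∷ hi)
top-of-lower-face l c lo≢hi = ≤∷≺⇒≺ ≤-refl (cube-≼ c , lo≢hi) , <∷≼⇒≺ (n<1+n l) ≼-refl

bottom-of-upper-face : ∀ {d} l {lo hi : Elem d} → Cube lo hi → lo ≢ hi → Inner (l ∷ lo) (suc l ∷ hi) (suc l ∷ lo)
bottom-of-upper-face l c lo≢hi = <∷≼⇒≺ (n<1+n l) ≼-refl , ≤∷≺⇒≺ ≤-refl (cube-≼ c , lo≢hi)

endpoint-or-inner : ∀ {d} (x lo hi : Elem d) → (x ≡ lo ⊎ x ≡ hi) ⊎ (x ≢ lo × x ≢ hi)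
endpoint-or-inner x lo hi with x ≟ᵉ lo | x ≟ᵉ hi
... | yes x≡lo | _ = inj₁ (inj₁ x≡lo)
... | no _ | yes x≡hi = inj₁ (inj₂ x≡hi)
... | no x≢lo | no x≢hi = inj₂ (x≢lo , x≢hi)

CubePair : ∀ {d} {lo hi : Elem d} → Cube lo hi → Elem d → Set
CubePair {lo = lo} {hi} c x = Inner lo hi (cubeTwin c x) × cubeTwin c (cubeTwin c x) ≡ x × cubeTwin c x ≢ x

cubeTwin-pairs : ∀ {d} {lo hi : Elem d} (c : Cube lo hi) {x} → Inner lo hi x → CubePair c x

lower-top-pair : ∀ {d} l {lo hi : Elem d} (c : Cube lo hi) → lo ≢ hi → CubePair (free l c) (l ∷ hi)
lower-top-pair l c lo≢hi rewrite cubeTwin-free-top l c | cubeTwin-free-bottom l c =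
  bottom-of-upper-face l c lo≢hi , refl , 1+n≢n ∘ VecP.∷-injectiveˡ

upper-bottom-pair : ∀ {d} l {lo hi : Elem d} (c : Cube lo hi) → lo ≢ hi → CubePair (free l c) (suc l ∷ lo)
upper-bottom-pair l c lo≢hi rewrite cubeTwin-free-bottom l c | cubeTwin-free-top l c =
  top-of-lower-face l c lo≢hi , refl , 1+n≢n ∘ sym ∘ VecP.∷-injectiveˡ

face-pair : ∀ {d} l {lo hi : Elem d} (c : Cube lo hi) {m xs} → l ≤ m → m ≤ suc l → Inner lo hi xs →
  CubePair (free l c) (m ∷ xs)
face-pair l c {m} l≤m m≤1+l xs∈@((_ , lo≢xs) , (_ , xs≢hi))
  with t∈@((_ , lo≢t) , (_ , t≢hi)) , tt≡xs , t≢xs ← cubeTwin-pairs c xs∈ =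
  subst (Inner _ _) (sym twin-xs) (lift-face l≤m m≤1+l t∈) ,
  trans (cong (cubeTwin (free l c)) twin-xs) (trans twin-t (cong (m ∷_) tt≡xs)) ,
  λ e → t≢xs (VecP.∷-injectiveʳ (trans (sym twin-xs) e))
  where
  twin-xs = cubeTwin-free-face l c (tail-≢ xs≢hi) (tail-≢ (lo≢xs ∘ sym))
  twin-t = cubeTwin-free-face l c (tail-≢ t≢hi) (tail-≢ (lo≢t ∘ sym))

cubeTwin-pairs [] (([] , []≢[]) , _) = contradiction refl []≢[]
cubeTwin-pairs (fixed l c) {x ∷ xs} (lo≺x@(l≤x ∷ _ , _) , x≺hi@(x≤l ∷ _ , _)) with ≤-antisym x≤l l≤x
... | refl with t∈ , tt≡xs , t≢xs ← cubeTwin-pairs c (∷-≺-∷⁻ lo≺x , ∷-≺-∷⁻ x≺hi) =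
  lift-face ≤-refl ≤-refl t∈ , cong (l ∷_) tt≡xs , t≢xs ∘ VecP.∷-injectiveʳ
cubeTwin-pairs (free l {lo} {hi} c) {x ∷ xs} ((l≤x ∷ lo≼xs , lo≢x) , (x≤1+l ∷ xs≼hi , x≢hi))
  with endpoint-or-inner xs lo hi
... | inj₂ (xs≢lo , xs≢hi) = face-pair l c l≤x x≤1+l ((lo≼xs , xs≢lo ∘ sym) , (xs≼hi , xs≢hi))
... | inj₁ (inj₁ refl) with between-suc l≤x x≤1+l
...   | inj₁ refl = contradiction refl lo≢x
...   | inj₂ refl = upper-bottom-pair l c (x≢hi ∘ cong (suc l ∷_))
cubeTwin-pairs (free l {lo} {hi} c) {x ∷ xs} ((l≤x ∷ _ , lo≢x) , (x≤1+l ∷ _ , x≢hi)) | inj₁ (inj₂ refl)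
  with between-suc l≤x x≤1+l
... | inj₁ refl = lower-top-pair l c (lo≢x ∘ cong (l ∷_))
... | inj₂ refl = contradiction refl x≢hi

InnerChain : ∀ {d} → (Elem d → Set) → Elem d → Elem d → List (Elem d) → Set
InnerChain S lo hi ch = AllPairs _≺_ ch × All (λ x → S x × Inner lo hi x) ch

lift-chain : ∀ {d} {S : Elem (suc d) → Set} {l m h} {lo hi : Elem d} {ch} → l ≤ m → m ≤ h →
  InnerChain (S ∘ (m ∷_)) lo hi ch → InnerChain S (l ∷ lo) (h ∷ hi) (List.map (m ∷_) ch)
lift-chain l≤m m≤h (ch↑ , ch∈) =
  AllPairsP.map⁺ (AllPairs.map (≤∷≺⇒≺ ≤-refl) ch↑) ,
  AllP.map⁺ (All.map (λ (s , y∈) → s , lift-face l≤m m≤h y∈) ch∈)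

lower-face-chain : ∀ {d} {S : Elem (suc d) → Set} l {lo hi : Elem d} (c : Cube lo hi) {ch} → lo ≢ hi →
  S (l ∷ hi) → InnerChain (S ∘ (l ∷_)) lo hi ch →
  InnerChain S (l ∷ lo) (suc l ∷ hi) (List.map (l ∷_) ch ++ [ l ∷ hi ])
lower-face-chain {S = S} l c lo≢hi S-top ch-inner@(_ , ch∈)
  with ch↑′ , ch∈′ ← lift-chain {S = S} ≤-refl (n≤1+n l) ch-inner =
  AllPairsP.++⁺ ch↑′ ([] ∷ []) (AllP.map⁺ (All.map (λ (_ , _ , y≺hi) → ≤∷≺⇒≺ ≤-refl y≺hi ∷ []) ch∈)) ,
  AllP.++⁺ ch∈′ ((S-top , top-of-lower-face l c lo≢hi) ∷ [])

upper-face-chain : ∀ {d} {S : Elem (suc d) → Set} l {lo hi : Elem d} (c : Cube lo hi) {ch} → lo ≢ hi →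
  S (suc l ∷ lo) → InnerChain (S ∘ (suc l ∷_)) lo hi ch →
  InnerChain S (l ∷ lo) (suc l ∷ hi) ((suc l ∷ lo) ∷ List.map (suc l ∷_) ch)
upper-face-chain {S = S} l c lo≢hi S-bottom ch-inner@(_ , ch∈)
  with ch↑′ , ch∈′ ← lift-chain {S = S} (n≤1+n l) ≤-refl ch-inner =
  AllP.map⁺ (All.map (λ (_ , lo≺y , _) → ≤∷≺⇒≺ ≤-refl lo≺y) ch∈) ∷ ch↑′ ,
  (S-bottom , bottom-of-upper-face l c lo≢hi) ∷ ch∈′

face-hypothesis : ∀ {d} {S : Elem (suc d) → Set} l {m lo hi} (c : Cube lo hi) → l ≤ m → m ≤ suc l →
  (∀ x → Inner (l ∷ lo) (suc l ∷ hi) x → S x ⊎ S (cubeTwin (free l c) x)) →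
  (∀ y → Inner lo hi y → S (m ∷ y) ⊎ S (m ∷ cubeTwin c y))
face-hypothesis {S = S} l c l≤m m≤1+l hyp y y∈@((_ , lo≢y) , (_ , y≢hi)) =
  Sum.map₂ (subst S (cubeTwin-free-face l c (tail-≢ y≢hi) (tail-≢ (lo≢y ∘ sym))))
    (hyp _ (lift-face l≤m m≤1+l y∈))

rank-shift : ∀ l {a n b} → suc (a + n) ≡ b → l + a + suc n ≡ l + b
rank-shift l {a} {n} len = trans (+-assoc l a (suc n)) (cong (l +_) (trans (+-suc a n) len))

length-map-∷ʳ : ∀ {A B : Set} (f : A → B) xs {y} → length (List.map f xs ++ [ y ]) ≡ suc (length xs)
length-map-∷ʳ f xs = trans (length-++ (List.map f xs)) (trans (+-comm _ 1) (cong suc (length-map f xs)))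

cube-chain : ∀ {d} {lo hi : Elem d} (c : Cube lo hi) → lo ≢ hi → (S : Elem d → Set) →
  (∀ x → Inner lo hi x → S x ⊎ S (cubeTwin c x)) →
  Σ (List (Elem d)) λ ch → InnerChain S lo hi ch × suc (rank lo + length ch) ≡ rank hi
cube-chain [] []≢[] _ _ = contradiction refl []≢[]
cube-chain (fixed l {lo} c) lo≢hi S hyp
  with ch , ch-inner , len ← cube-chain c (lo≢hi ∘ cong (l ∷_)) (S ∘ (l ∷_)) (λ y y∈ → hyp (l ∷ y) (lift-face ≤-refl ≤-refl y∈)) =
  List.map (l ∷_) ch , lift-chain ≤-refl ≤-refl ch-inner ,
  trans (cong (λ n → suc (l + rank lo + n)) (length-map (l ∷_) ch)) (trans (sym (+-suc _ _)) (rank-shift l len))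
cube-chain (free l {lo} {hi} c) _ S hyp with lo ≟ᵉ hi
... | yes refl = [] , ([] , []) , cong suc (+-identityʳ _)
... | no lo≢hi with hyp (l ∷ hi) (top-of-lower-face l c lo≢hi)
...   | inj₁ S-top
  with ch , ch-inner , len ← cube-chain c lo≢hi (S ∘ (l ∷_)) (face-hypothesis l c ≤-refl (n≤1+n l) hyp) =
  List.map (l ∷_) ch ++ [ l ∷ hi ] , lower-face-chain l c lo≢hi S-top ch-inner ,
  cong suc (trans (cong (l + rank lo +_) (length-map-∷ʳ (l ∷_) ch)) (rank-shift l len))
...   | inj₂ S-bottom
  with ch , ch-inner , len ← cube-chain c lo≢hi (S ∘ (suc l ∷_)) (face-hypothesis l c (n≤1+n l) ≤-refl hyp) =
  (suc l ∷ lo) ∷ List.map (suc l ∷_) ch ,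
  upper-face-chain l c lo≢hi (subst S (cubeTwin-free-top l c) S-bottom) ch-inner ,
  cong suc (trans (cong (λ n → l + rank lo + suc n) (length-map (suc l ∷_) ch)) (rank-shift l len))

pivot : ∀ {d} → Vec ℕ d → ℕ → Elem d
pivot r t = map (λ n → t ⊓ pred n) r

pivot-InP : ∀ {d} {r : Vec ℕ d} → VecAll (1 ≤_) r → ∀ t → InP r (pivot r t)
pivot-InP []ᵛ t = []
pivot-InP {r = suc n ∷ r} (_ ∷ᵛ r≥1) t = s≤s (m⊓n≤n t n) ∷ pivot-InP r≥1 t

⊓-step : ∀ t m → suc t ⊓ m ≡ t ⊓ m ⊎ suc t ⊓ m ≡ suc (t ⊓ m)
⊓-step zero zero = inj₁ refl
⊓-step (suc t) zero = inj₁ refl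
⊓-step zero (suc m) = inj₂ refl
⊓-step (suc t) (suc m) = Sum.map (cong suc) (cong suc) (⊓-step t m)

pivot-cube : ∀ {d} (r : Vec ℕ d) t → Cube (pivot r t) (pivot r (suc t))
pivot-cube [] t = []
pivot-cube (n ∷ r) t with ⊓-step t (pred n)
... | inj₁ e rewrite e = fixed _ (pivot-cube r t)
... | inj₂ e rewrite e = free _ (pivot-cube r t)

maxVec-mono : ∀ {d} {x y : Elem d} → x ≼ y → maxVec x ≤ maxVec y
maxVec-mono [] = z≤n
maxVec-mono (a ∷ as) = ⊔-mono-≤ a (maxVec-mono as)

maxVec-pivot : ∀ {d} (r : Vec ℕ d) t → maxVec (pivot r t) ≡ t ⊓ pred (maxVec r)
maxVec-pivot [] t = sym (⊓-zeroʳ t)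
maxVec-pivot (n ∷ r) t = begin
  t ⊓ pred n ⊔ maxVec (pivot r t)      ≡⟨ cong (t ⊓ pred n ⊔_) (maxVec-pivot r t) ⟩
  t ⊓ pred n ⊔ t ⊓ pred (maxVec r)     ≡⟨ ⊓-distribˡ-⊔ t (pred n) _ ⟨
  t ⊓ (pred n ⊔ pred (maxVec r))       ≡⟨ cong (t ⊓_) (mono-≤-distrib-⊔ pred-mono-≤ n (maxVec r)) ⟨
  t ⊓ pred (n ⊔ maxVec r)              ∎
  where open ≡-Reasoning

maxVec-upper : ∀ {d} (r : Vec ℕ d) → VecAll (_≤ maxVec r) r
maxVec-upper [] = []ᵛ
maxVec-upper (n ∷ r) = m≤m⊔n n _ ∷ᵛ Data.Vec.Relation.Unary.All.map (λ m≤ → ≤-trans m≤ (m≤n⊔m n _)) (maxVec-upper r)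

pivot-last : ∀ {d} (r : Vec ℕ d) → pivot r (pred (maxVec r)) ≡ map pred r
pivot-last r = go (maxVec-upper r)
  where
  go : ∀ {d} {s : Vec ℕ d} → VecAll (_≤ maxVec r) s → pivot s (pred (maxVec r)) ≡ map pred s
  go []ᵛ = refl
  go (n≤R ∷ᵛ s≤R) = cong₂ _∷_ (m≥n⇒m⊓n≡n (pred-mono-≤ n≤R)) (go s≤R)

⊓<⇒< : ∀ {t m x} → t ⊓ m < x → x ≤ m → t < x
⊓<⇒< {t} {m} {x} t⊓m<x x≤m = ≰⇒> λ x≤t → <⇒≱ t⊓m<x (⊓-glb x≤t x≤m)

pivot-≺⇒< : ∀ {d} (r : Vec ℕ d) t {x} → pivot r t ≺ x → x ≼ pivot r (suc t) → t < maxVec x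
pivot-≺⇒< [] t ([] , []≢[]) _ = contradiction refl []≢[]
pivot-≺⇒< (n ∷ r) t {x ∷ xs} (p≤x ∷ ps≼xs , p≢x) (x≤p′ ∷ xs≼ps′) with t ⊓ pred n ≟ x
... | yes refl = ≤-trans (pivot-≺⇒< r t (ps≼xs , p≢x ∘ cong (x ∷_)) xs≼ps′) (m≤n⊔m x _)
... | no p≢x₀ = ≤-trans (⊓<⇒< (≤∧≢⇒< p≤x p≢x₀) (≤-trans x≤p′ (m⊓n≤n (suc t) (pred n)))) (m≤m⊔n x _)

maxVec-pivot-≤ : ∀ {d} (r : Vec ℕ d) {t} → t ≤ pred (maxVec r) → maxVec (pivot r t) ≡ t
maxVec-pivot-≤ r t≤ = trans (maxVec-pivot r _) (m≤n⇒m⊓n≡m t≤)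

maxVec-inner : ∀ {d} (r : Vec ℕ d) {t x} → suc t ≤ pred (maxVec r) →
  Inner (pivot r t) (pivot r (suc t)) x → maxVec x ≡ suc t
maxVec-inner r {t} 1+t≤ (p≺x , (x≼p′ , _)) =
  ≤-antisym (≤-trans (maxVec-mono x≼p′) (≤-reflexive (maxVec-pivot-≤ r 1+t≤))) (pivot-≺⇒< r t p≺x x≼p′)

pivot-≺ : ∀ {d} (r : Vec ℕ d) {t} → suc t ≤ pred (maxVec r) → pivot r t ≺ pivot r (suc t)
pivot-≺ r {t} 1+t≤ = cube-≼ (pivot-cube r t) , λ e →
  1+n≢n (sym (trans (sym (maxVec-pivot-≤ r (≤-trans (n≤1+n t) 1+t≤))) (trans (cong maxVec e) (maxVec-pivot-≤ r 1+t≤))))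

twin-double : ∀ j {n} → suc (j * 2) < n → twin n (j * 2) ≡ suc (j * 2) × twin n (suc (j * 2)) ≡ j * 2
twin-double zero {suc (suc n)} _ = refl , refl
twin-double zero {suc zero} (s≤s ())
twin-double (suc j) {suc (suc n)} (s≤s (s≤s lt)) with twin-double j {n} lt
... | e₁ , e₂ = cong (λ y → suc (suc y)) e₁ , cong (λ y → suc (suc y)) e₂

_≺?_ : ∀ {d} (x y : Elem d) → Dec (x ≺ y)
x ≺? y = PW.decidable _≤?_ x y ×-dec ¬? (x ≟ᵉ y)

module MakerPairing {d} (r : Vec ℕ d) where

  -- Pivots 1–2, 3–4, … are paired; pivot 0 is Maker's opening move.
  pivotTwin : ℕ → ℕ
  pivotTwin zero = zero
  pivotTwin (suc t) = suc (twin (pred (maxVec r)) t)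

  makerTwinAt : ℕ → Elem d → Elem d
  makerTwinAt zero x = x
  makerTwinAt (suc t) x with x ≟ᵉ pivot r (suc t)
  ... | yes _ = pivot r (pivotTwin (suc t))
  ... | no _ with pivot r t ≺? x ×-dec x ≺? pivot r (suc t)
  ...   | yes _ = cubeTwin (pivot-cube r t) x
  ...   | no _ = x

  -- The level maxVec x = t + 1 locates x in the cube from pivot t to pivot (t + 1) (see maxVec-inner).
  makerTwin : Elem d → Elem d
  makerTwin x = makerTwinAt (maxVec x) x

  makerTwin-inner : ∀ {t x} → suc t ≤ pred (maxVec r) → Inner (pivot r t) (pivot r (suc t)) x →
    makerTwin x ≡ cubeTwin (pivot-cube r t) x
  makerTwin-inner {t} {x} 1+t≤ x∈@(_ , (_ , x≢p)) rewrite maxVec-inner r 1+t≤ x∈ with x ≟ᵉ pivot r (suc t)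
  ... | yes x≡p = contradiction x≡p x≢p
  ... | no _ with pivot r t ≺? x ×-dec x ≺? pivot r (suc t)
  ...   | yes _ = refl
  ...   | no x∉ = contradiction x∈ x∉

  makerTwin-pivot : ∀ {t} → suc t ≤ pred (maxVec r) → makerTwin (pivot r (suc t)) ≡ pivot r (pivotTwin (suc t))
  makerTwin-pivot {t} 1+t≤ rewrite maxVec-pivot-≤ r 1+t≤ with pivot r (suc t) ≟ᵉ pivot r (suc t)
  ... | yes _ = refl
  ... | no p≢p = contradiction refl p≢p

  makerTwin-pivot-pair : ∀ j → suc (suc (j * 2)) ≤ pred (maxVec r) →
    makerTwin (pivot r (suc (j * 2))) ≡ pivot r (suc (suc (j * 2))) ×
    makerTwin (pivot r (suc (suc (j * 2)))) ≡ pivot r (suc (j * 2))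
  makerTwin-pivot-pair j 2+2j≤ with twin-double j 2+2j≤
  ... | e₁ , e₂ = trans (makerTwin-pivot (≤-trans (n≤1+n _) 2+2j≤)) (cong (pivot r ∘ suc) e₁) ,
                  trans (makerTwin-pivot 2+2j≤) (cong (pivot r ∘ suc) e₂)

⌊n/2⌋*2≤n : ∀ n → ⌊ n /2⌋ * 2 ≤ n
⌊n/2⌋*2≤n zero = z≤n
⌊n/2⌋*2≤n (suc zero) = z≤n
⌊n/2⌋*2≤n (suc (suc n)) = s≤s (s≤s (⌊n/2⌋*2≤n n))

chain-step-arithmetic : ∀ a c n t L b → a + c < n + t → suc (a + L) + (c + b) < n + (L + b) + suc t
chain-step-arithmetic a c n t L b h = subst₂ _≤_ (lhs a c L b) (rhs n t L b) (+-monoˡ-≤ (suc L + b) h)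
  where
  lhs : ∀ a c L b → suc (a + c) + (suc L + b) ≡ suc (suc (a + L) + (c + b))
  lhs = solve-∀
  rhs : ∀ n t L b → n + t + (suc L + b) ≡ n + (L + b) + suc t
  rhs = solve-∀

module Assembly {d} (r : Vec ℕ d) {S : Elem d → Set} (S? : Decidable S)
  (S-origin : S (origin r))
  (S-cubes : ∀ t → suc t ≤ pred (maxVec r) → ∀ x → Inner (pivot r t) (pivot r (suc t)) x →
             S x ⊎ S (cubeTwin (pivot-cube r t) x)) where

  pivotsInS : ℕ → ℕ
  pivotsInS zero = 0
  pivotsInS (suc t) = pivotsInS t + length (filter S? [ pivot r (suc t) ])

  ChainUpTo : ℕ → Set
  ChainUpTo t = Σ (List (Elem d)) λ ch → AllPairs _≺_ ch × All S ch × All (_≼ pivot r t) ch ×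
    rank (pivot r t) + pivotsInS t < length ch + t

  chain-up-to : ∀ t → t ≤ pred (maxVec r) → ChainUpTo t
  chain-up-to zero _ =
    [ origin r ] , [] ∷ [] , S-origin ∷ [] , ≼-refl ∷ [] , s≤s (≤-reflexive (trans (+-identityʳ _) (rank-origin r)))
  chain-up-to (suc t) 1+t≤
    with ch , ch↑ , chS , ch≼ , len ← chain-up-to t (≤-trans (n≤1+n t) 1+t≤)
       | cube , (cube↑ , cube∈) , cube-len ← cube-chain (pivot-cube r t) (proj₂ (pivot-≺ r 1+t≤)) S (S-cubes t 1+t≤) =
    ch ++ cube ++ new ,
    AllPairsP.++⁺ ch↑ (AllPairsP.++⁺ cube↑ new↑ cube≺new) ch≺rest ,
    AllP.++⁺ chS (AllP.++⁺ (All.map proj₁ cube∈) (AllP.all-filter S? _)) ,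
    AllP.++⁺ (All.map (λ x≼p → ≼-trans x≼p (cube-≼ (pivot-cube r t))) ch≼)
             (AllP.++⁺ (All.map (λ (_ , _ , y≼p′ , _) → y≼p′) cube∈) (AllP.filter⁺ S? (≼-refl ∷ []))) ,
    subst₂ _<_ (cong (_+ pivotsInS (suc t)) cube-len) (cong (_+ suc t) (sym length-rest))
      (chain-step-arithmetic (rank (pivot r t)) (pivotsInS t) (length ch) t (length cube) (length new) len)
    where
    new = filter S? [ pivot r (suc t) ]
    new↑ : AllPairs _≺_ new
    new↑ = AllPairsP.filter⁺ S? ([] ∷ [])
    cube≺new : All (λ y → All (y ≺_) new) cube
    cube≺new = All.map (λ (_ , _ , y≺p′) → AllP.filter⁺ S? (y≺p′ ∷ [])) cube∈
    ch≺rest : All (λ x → All (x ≺_) (cube ++ new)) ch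
    ch≺rest = All.map (λ x≼p → AllP.++⁺ (All.map (λ (_ , p≺y , _) → ≼-≺-trans x≼p p≺y) cube∈)
                                         (AllP.filter⁺ S? (≼-≺-trans x≼p (pivot-≺ r 1+t≤) ∷ []))) ch≼
    length-rest : length (ch ++ cube ++ new) ≡ length ch + (length cube + length new)
    length-rest = trans (length-++ ch) (cong (length ch +_) (length-++ cube))

  pivotsInS-mono : ∀ {s t} → s ≤ t → pivotsInS s ≤ pivotsInS t
  pivotsInS-mono {t = zero} z≤n = ≤-refl
  pivotsInS-mono {t = suc t} s≤1+t with m≤n⇒m<n∨m≡n s≤1+t
  ... | inj₁ s<1+t = ≤-trans (pivotsInS-mono (s≤s⁻¹ s<1+t)) (m≤m+n _ _)
  ... | inj₂ refl = ≤-refl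

  one-of-pair-counted : ∀ {x y} → S x ⊎ S y → 1 ≤ length (filter S? [ x ]) + length (filter S? [ y ])
  one-of-pair-counted (inj₁ Sx) rewrite filter-accept S? {xs = []} Sx = s≤s z≤n
  one-of-pair-counted {x} (inj₂ Sy) rewrite filter-accept S? {xs = []} Sy = m≤n+m 1 _

  module Counting (S-pivot-pairs : ∀ j → suc (suc (j * 2)) ≤ pred (maxVec r) →
                                   S (pivot r (suc (j * 2))) ⊎ S (pivot r (suc (suc (j * 2))))) where

    pairs-counted : ∀ j → j * 2 ≤ pred (maxVec r) → j ≤ pivotsInS (j * 2)
    pairs-counted zero _ = z≤n
    pairs-counted (suc j) 2+2j≤ = begin
      suc j                                                   ≡⟨ +-comm 1 j ⟩
      j + 1                                                   ≤⟨ +-mono-≤ (pairs-counted j (≤-trans (m≤n+m _ 2) 2+2j≤))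
                                                                          (one-of-pair-counted (S-pivot-pairs j 2+2j≤)) ⟩
      pivotsInS (j * 2) + (count (suc (j * 2)) + count (suc (suc (j * 2)))) ≡⟨ +-assoc (pivotsInS (j * 2)) _ _ ⟨
      pivotsInS (suc (suc (j * 2)))                           ∎
      where
      open ≤-Reasoning
      count = λ t → length (filter S? [ pivot r t ])

    half-counted : ⌊ pred (maxVec r) /2⌋ ≤ pivotsInS (pred (maxVec r))
    half-counted = ≤-trans (pairs-counted _ (⌊n/2⌋*2≤n _)) (pivotsInS-mono (⌊n/2⌋*2≤n (pred (maxVec r))))

long-chain : ∀ {d} {r : Vec ℕ d} → VecAll (1 ≤_) r → Σ (List (Elem d)) λ ch → IsChain r ch × suc (height r) ≤ length ch
long-chain {r = r} r≥1 = full-chain (chain-up-to (pred (maxVec r)) ≤-refl)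
  where
  open Assembly r {S = λ _ → ⊤} (λ _ → yes tt) tt (λ _ _ _ _ → inj₁ tt)
  pivotsInS-all : ∀ t → pivotsInS t ≡ t
  pivotsInS-all zero = refl
  pivotsInS-all (suc t) = trans (+-comm (pivotsInS t) 1) (cong suc (pivotsInS-all t))

  full-chain : ChainUpTo (pred (maxVec r)) → Σ (List (Elem _)) λ ch → IsChain r ch × suc (height r) ≤ length ch
  full-chain (ch , ch↑ , _ , ch≼ , len) =
    ch , IsChain-≺ ch↑ (All.map (λ x≼ → ≼-InP x≼ (pivot-InP r≥1 _)) ch≼) ,
    +-cancelʳ-≤ (pred (maxVec r)) (suc (height r)) (length ch)
      (subst₂ (λ a b → suc (a + b) ≤ length ch + pred (maxVec r)) (cong rank (pivot-last r)) (pivotsInS-all _) len)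

max-chain-size : ∀ {d} {r : Vec ℕ d} {k} → VecAll (1 ≤_) r → IsMaxChainSize r k → k ≡ suc (height r)
max-chain-size {r = r} r≥1 ((c , c-chain , refl) , maximal) with ch , ch-chain , long ← long-chain r≥1 =
  ≤-antisym (chain-length≤1+height r c-chain) (≤-trans long (maximal ch ch-chain))

MakerHasChain-take : ∀ {d} {r : Vec ℕ d} {p ch} n → AllPairs _≺_ ch → All (InP r) ch →
  All (_∈ makerMoves p) ch → n ≤ length ch → MakerHasChain r n p
MakerHasChain-take {ch = ch} n ch↑ ch∈P ch⊆M n≤ =
  List.take n ch , IsChain-≺ (AllPairsP.take⁺ n ch↑) (AllP.take⁺ n ch∈P) , AllP.take⁺ n ch⊆M ,
  trans (length-take n ch) (m≤n⇒m⊓n≡m n≤)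

first-move-taken : ∀ {d} {σ : Strategy d} {p x} → x ∈ p → Follows 0 σ p → σ [] ∈ makerMoves p
first-move-taken {p = m ∷ t} _ follows = here (sym (follows [] m t refl refl))

pred≡⌊pred/2⌋+⌊/2⌋ : ∀ n → pred n ≡ ⌊ pred n /2⌋ + ⌊ n /2⌋
pred≡⌊pred/2⌋+⌊/2⌋ zero = refl
pred≡⌊pred/2⌋+⌊/2⌋ (suc n) = sym (⌊n/2⌋+⌈n/2⌉≡n n)

maker-length-arithmetic : ∀ H c L h R′ → H + c < L + (h + R′) → h ≤ c → suc H ∸ R′ ≤ L
maker-length-arithmetic H c L h R′ lt h≤c = m≤n+o⇒m∸n≤o (suc H) R′ (+-cancelʳ-≤ h (suc H) (R′ + L) (begin
  suc H + h       ≤⟨ s≤s (+-monoʳ-≤ H h≤c) ⟩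
  suc (H + c)     ≤⟨ lt ⟩
  L + (h + R′)    ≡⟨ rearrange L h R′ ⟩
  R′ + L + h      ∎))
  where
  open ≤-Reasoning
  rearrange : ∀ L h R′ → L + (h + R′) ≡ R′ + L + h
  rearrange = solve-∀

module MakerPlay {d} (r : Vec ℕ d) (r≥1 : VecAll (1 ≤_) r) where

  open MakerPairing r
  open PairingStrategy (InP? r) (elements r) (elements-sound r) (elements-complete r)
                       (origin r) (origin-InP r≥1) makerTwin public

  module _ (p : List (Elem d)) (p-unique : Unique p) (p-covers : ∀ x → InP r x → x ∈ p)
           (follows : Follows 0 strategy p) where

    open Play 0 z≤n p p-unique p-covers follows

    Maker : Elem d → Set
    Maker x = x ∈ makerMoves p

    gets-one : ∀ {x} → InP r x → makerTwin x ≢ x → makerTwin (makerTwin x) ≡ x → InP r (makerTwin x) →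
      Maker x ⊎ Maker (makerTwin x)
    gets-one x∈P y≢x yy≡x y∈P =
      Sum.map PlayedAt⇒∈makerMoves PlayedAt⇒∈makerMoves (pairing-player-gets-one _ x∈P y≢x yy≡x y∈P)

    cubes-hit : ∀ t → suc t ≤ pred (maxVec r) → ∀ x → Inner (pivot r t) (pivot r (suc t)) x →
      Maker x ⊎ Maker (cubeTwin (pivot-cube r t) x)
    cubes-hit t 1+t≤ x x∈ with y∈ , yy≡x , y≢x ← cubeTwin-pairs (pivot-cube r t) x∈ =
      subst (λ y → Maker x ⊎ Maker y) twin≡
        (gets-one (inner-InP x∈) (subst (_≢ x) (sym twin≡) y≢x)
          (trans (cong makerTwin twin≡) (trans (makerTwin-inner 1+t≤ y∈) yy≡x))
          (subst (InP r) (sym twin≡) (inner-InP y∈)))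
      where
      twin≡ = makerTwin-inner 1+t≤ x∈
      inner-InP : ∀ {y} → Inner (pivot r t) (pivot r (suc t)) y → InP r y
      inner-InP (_ , (y≼p′ , _)) = ≼-InP y≼p′ (pivot-InP r≥1 (suc t))

    pivot-pairs-hit : ∀ j → suc (suc (j * 2)) ≤ pred (maxVec r) →
      Maker (pivot r (suc (j * 2))) ⊎ Maker (pivot r (suc (suc (j * 2))))
    pivot-pairs-hit j 2+2j≤ with e₁ , e₂ ← makerTwin-pivot-pair j 2+2j≤ =
      subst (λ y → Maker (pivot r (suc (j * 2))) ⊎ Maker y) e₁
        (gets-one (pivot-InP r≥1 (suc (j * 2))) (λ e → proj₂ (pivot-≺ r 2+2j≤) (sym (trans (sym e₁) e)))
          (trans (cong makerTwin e₁) e₂) (subst (InP r) (sym e₁) (pivot-InP r≥1 _)))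

    open Assembly r (λ x → DecMembership._∈?_ _≟ᵉ_ x (makerMoves p))
                  (first-move-taken (p-covers _ (origin-InP r≥1)) follows) cubes-hit
    open Counting pivot-pairs-hit

    maker-chain-from : ChainUpTo (pred (maxVec r)) → MakerHasChain r (suc (height r) ∸ ⌊ maxVec r /2⌋) p
    maker-chain-from (ch , ch↑ , ch⊆M , ch≼ , len) =
      MakerHasChain-take _ ch↑ (All.map (λ x≼ → ≼-InP x≼ (pivot-InP r≥1 _)) ch≼) ch⊆M
        (maker-length-arithmetic (height r) (pivotsInS (pred (maxVec r))) (length ch)
          ⌊ pred (maxVec r) /2⌋ ⌊ maxVec r /2⌋
          (subst₂ (λ a b → suc (a + pivotsInS (pred (maxVec r))) ≤ length ch + b)
            (cong rank (pivot-last r)) (pred≡⌊pred/2⌋+⌊/2⌋ (maxVec r)) len)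
          half-counted)

    maker-chain : MakerHasChain r (suc (height r) ∸ ⌊ maxVec r /2⌋) p
    maker-chain = maker-chain-from (chain-up-to (pred (maxVec r)) ≤-refl)

maker-strategy : ∀ {d} (r : Vec ℕ d) → VecAll (1 ≤_) r →
  Σ (Strategy d) λ σ → LegalStrategy r σ ×
    (∀ p → IsPlay r p → Follows 0 σ p → MakerHasChain r (suc (height r) ∸ ⌊ maxVec r /2⌋) p)
maker-strategy r r≥1 =
  strategy , (λ h _ _ free → strategy-legal h free) ,
  λ p (p-unique , _ , p-covers) follows → maker-chain p p-unique p-covers follows
  where open MakerPlay r r≥1

maxVec-attained : ∀ {d} → 1 ≤ d → (r : Vec ℕ d) → ∃ λ i → lookup r i ≡ maxVec r
maxVec-attained _ (n ∷ []) = zero , sym (⊔-identityʳ n)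
maxVec-attained _ (n ∷ m ∷ r) with maxVec-attained (s≤s z≤n) (m ∷ r) | ≤-total n (maxVec (m ∷ r))
... | i , e | inj₁ n≤ = suc i , trans e (sym (m≤n⇒m⊔n≡n n≤))
... | _ | inj₂ ≤n = zero , sym (m≥n⇒m⊔n≡m ≤n)

/2≡⌊/2⌋ : ∀ n → n / 2 ≡ ⌊ n /2⌋
/2≡⌊/2⌋ zero = refl
/2≡⌊/2⌋ (suc zero) = refl
/2≡⌊/2⌋ (suc (suc n)) = trans (m/n≡1+[m∸n]/n {suc (suc n)} {2} (s≤s (s≤s z≤n))) (cong suc (/2≡⌊/2⌋ n))

theorem1 : (d : ℕ) → 1 ≤ d → (r : Vec ℕ d) → VecAll (1 ≤_) r →
    (k : ℕ) → IsMaxChainSize r k →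
    (Σ (Strategy d) λ σ → LegalStrategy r σ ×
       (∀ p → IsPlay r p → Follows 0 σ p → MakerHasChain r (k ∸ (maxVec r / 2)) p))
    ×
    (Σ (Strategy d) λ τ → LegalStrategy r τ ×
       (∀ p → IsPlay r p → Follows 1 τ p → MakerChainsAtMost r (k ∸ (maxVec r / 2)) p))
theorem1 d d≥1 r r≥1 k k-max rewrite max-chain-size r≥1 k-max | /2≡⌊/2⌋ (maxVec r) =
  maker-strategy r r≥1 , breaker-along-longest (maxVec-attained d≥1 r)
  where
  breaker-along-longest : (∃ λ i → lookup r i ≡ maxVec r) →
    Σ (Strategy d) λ τ → LegalStrategy r τ ×
      (∀ p → IsPlay r p → Follows 1 τ p → MakerChainsAtMost r (suc (height r) ∸ ⌊ maxVec r /2⌋) p)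
  breaker-along-longest (i , rᵢ≡R) rewrite sym rᵢ≡R = breaker-strategy r r≥1 i
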